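{- For all integers $n,j\geq 1$, \[\overline{p}(n-j^2)=op_{2,1}(n,j)+op_{2,1}(n,j+1).\]
   Context: An overpartition of $n$ is a partition of $n$ in which the last occurrence of each part size may be overlined. $\overline{p}(n)$ denotes the number of overpartitions of $n$, with $\overline{p}(0)=1$ and $\overline{p}(n)=0$ for $n<0$. For an overpartition $\pi$, $\overline{mex}_{2,1}(\pi)$ denotes the smallest positive odd integer that does not occur as a non-overlined part of $\pi$. For $n\geq 1$ and $k\geq 0$, $op_{2,1}(n,k)$ denotes the number of overpartitions $\pi$ of $n$ such that $\overline{mex}_{2,1}(\pi)\geq 2k+1$ and $\overline{mex}_{2,1}(\pi)\equiv 2k+1 \pmod 4$. -}

module Defs where

open import Data.Nat using (ℕ; zero; suc; _+_; _*_; _≡ᵇ_; _<ᵇ_; _≤ᵇ_; _%_)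
open import Data.Bool using (Bool; true; false; _∧_; _∨_; not; if_then_else_)
open import Data.Product using (_×_; _,_)
open import Data.List using (List; []; _∷_; map; concatMap; length; upTo)
open import Data.Integer using (ℤ; +_; -[1+_])

-- A part of an overpartition: (size , overlined?)
Part : Set
Part = ℕ × Bool

sizeSum : List Part → ℕ
sizeSum []            = 0
sizeSum ((s , _) ∷ π) = s + sizeSum π

-- Canonical (weakly decreasing) listing of an overpartition:
-- every part is positive; consecutive parts (s₁,b₁),(s₂,b₂) satisfy
-- s₁ > s₂, or s₁ = s₂ and the first is NOT overlined.
-- Hence for each size at most one copy is overlined, and it is the last occurrence.
adjOK : Part → Part → Bool
adjOK (s₁ , b₁) (s₂ , b₂) = (s₂ <ᵇ s₁) ∨ ((s₁ ≡ᵇ s₂) ∧ not b₁)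

validᵇ : List Part → Bool
validᵇ []                 = true
validᵇ ((s , b) ∷ [])     = 0 <ᵇ s
validᵇ (p ∷ (q ∷ π))      = (0 <ᵇ Data.Product.proj₁ p) ∧ adjOK p q ∧ validᵇ (q ∷ π)

isOverpartitionᵇ : ℕ → List Part → Bool
isOverpartitionᵇ n π = (sizeSum π ≡ᵇ n) ∧ validᵇ π

listsOfLen : {A : Set} → ℕ → List A → List (List A)
listsOfLen zero    xs = [] ∷ []
listsOfLen (suc k) xs = concatMap (λ x → map (x ∷_) (listsOfLen k xs)) xs

partsUpTo : ℕ → List Part
partsUpTo n = concatMap (λ i → (suc i , false) ∷ (suc i , true) ∷ []) (upTo n)

-- every overpartition of n appears exactly once in this list
-- (it has at most n parts, each of size between 1 and n)
candidates : ℕ → List (List Part)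
candidates n = concatMap (λ k → listsOfLen k (partsUpTo n)) (upTo (suc n))

countᵇ : {A : Set} → (A → Bool) → List A → ℕ
countᵇ P []       = 0
countᵇ P (x ∷ xs) = if P x then suc (countᵇ P xs) else countᵇ P xs

-- p̄(n): number of overpartitions of n  (p̄(0) = 1: the empty overpartition)
pbar : ℕ → ℕ
pbar n = countᵇ (isOverpartitionᵇ n) (candidates n)

pbarℤ : ℤ → ℕ
pbarℤ (+ n)    = pbar n
pbarℤ -[1+ _ ] = 0

occursNonOverlinedᵇ : ℕ → List Part → Bool
occursNonOverlinedᵇ m []                = false
occursNonOverlinedᵇ m ((s , b) ∷ π)     = ((s ≡ᵇ m) ∧ not b) ∨ occursNonOverlinedᵇ m π

-- search the odd numbers c, c+2, c+4, ... for the first not occurring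
-- non-overlined; fuel = length π suffices, since π has at most length π
-- distinct non-overlined odd part sizes.
mexAux : ℕ → ℕ → List Part → ℕ
mexAux zero    c π = c
mexAux (suc f) c π = if occursNonOverlinedᵇ c π then mexAux f (2 + c) π else c

-- mex̄_{2,1}(π): smallest positive odd integer not occurring as a non-overlined part
mex21 : List Part → ℕ
mex21 π = mexAux (length π) 1 π

opCondᵇ : ℕ → List Part → Bool
opCondᵇ k π = ((2 * k + 1) ≤ᵇ mex21 π) ∧ ((mex21 π % 4) ≡ᵇ ((2 * k + 1) % 4))

op21 : ℕ → ℕ → ℕ
op21 n k = countᵇ (λ π → isOverpartitionᵇ n π ∧ opCondᵇ k π) (candidates n)

-- An overpartition with mex̄₂,₁ ≥ 2j+1 contains 1, 3, …, 2j−1 as non-overlined parts; removing one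
-- copy of each is a bijection onto the overpartitions of n − j², with inverse the reinsertion.
-- Since mex̄₂,₁ is odd, "mex̄₂,₁ ≥ 2j+1" splits into "mex̄₂,₁ ≥ 2j+1 and ≡ 2j+1 (mod 4)" and
-- "mex̄₂,₁ ≥ 2j+3 and ≡ 2j+3 (mod 4)", which are counted by op₂,₁(n,j) and op₂,₁(n,j+1).
module Submission where

open import Defs
open import Data.Bool using (Bool; true; false; T; _∧_; _∨_; not)
open import Data.Bool.Properties using (T?; T-∧; T-∨; T-≡; T-not-≡; ∧-distribˡ-∨; ∨-zeroʳ)
open import Data.Integer using (+_; _-_)
open import Data.Integer.Properties using (m-n≡m⊖n; ⊖-≥; ⊖-<)
open import Data.List using (List; []; _∷_; _++_; map; concatMap; length; upTo; filter)
open import Data.List.Membership.Propositional using (_∈_; find; lose)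
open import Data.List.Membership.Propositional.Properties
  using (∈-∃++; ∈-filter⁺; ∈-filter⁻; ∈-map⁻; ∈-map⁺; ∈-upTo⁺; ∈-concatMap⁺; ∈-concatMap⁻)
open import Data.List.Properties using (length-++; ∷-injectiveʳ)
open import Data.List.Relation.Binary.Subset.Propositional using (_⊆_)
open import Data.List.Relation.Unary.Any as Any using (here; there)
open import Data.List.Relation.Unary.All using ([]; _∷_)
open import Data.List.Relation.Unary.AllPairs using ([]; _∷_)
open import Data.List.Relation.Unary.Unique.Propositional using (Unique)
open import Data.List.Relation.Unary.Unique.Propositional.Properties
  using (Unique[x∷xs]⇒x∉xs; filter⁺; ++⁺; map⁺; upTo⁺)
open import Data.Nat
  using (ℕ; zero; suc; _+_; _*_; _∸_; _%_; _≤_; _<_; _≥_; z≤n; s≤s; z<s; _≤ᵇ_; _≡ᵇ_; _<ᵇ_; _≟_; _≤?_)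
open import Data.Nat.Properties
open import Data.Nat.DivMod using ([m+n]%n≡m%n)
open import Data.Nat.Tactic.RingSolver using (solve-∀)
open import Data.Product using (_×_; _,_; proj₁; proj₂; ∃-syntax)
open import Data.Sum as Sum using (_⊎_; inj₁; inj₂)
open import Data.Unit using (⊤; tt)
open import Function using (_∘_)
open import Function.Bundles using (_⇔_; mk⇔; Equivalence)
open import Relation.Binary.PropositionalEquality
  using (_≡_; _≢_; _≗_; refl; sym; trans; cong; subst; module ≡-Reasoning)
open import Relation.Binary.Definitions using (tri<; tri≈; tri>)
open import Relation.Nullary using (¬_; yes; no; contradiction)

open Equivalence using (to; from)

module _ {A : Set} where

  countᵇ≡length∘filter : (P : A → Bool) (xs : List A) → countᵇ P xs ≡ length (filter (T? ∘ P) xs)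
  countᵇ≡length∘filter P [] = refl
  countᵇ≡length∘filter P (x ∷ xs) with P x
  ... | true  = cong suc (countᵇ≡length∘filter P xs)
  ... | false = countᵇ≡length∘filter P xs

  countᵇ-cong : {P Q : A → Bool} → P ≗ Q → (xs : List A) → countᵇ P xs ≡ countᵇ Q xs
  countᵇ-cong P≗Q [] = refl
  countᵇ-cong P≗Q (x ∷ xs) rewrite P≗Q x | countᵇ-cong P≗Q xs = refl

  countᵇ-none : (P : A → Bool) → (∀ x → ¬ T (P x)) → (xs : List A) → countᵇ P xs ≡ 0
  countᵇ-none P ¬P [] = refl
  countᵇ-none P ¬P (x ∷ xs) with P x | ¬P x
  ... | true  | ¬Px = contradiction tt ¬Px
  ... | false | _   = countᵇ-none P ¬P xs

  countᵇ-∨ : (P Q : A → Bool) → (∀ x → T (P x) → ¬ T (Q x)) → (xs : List A) →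
             countᵇ (λ x → P x ∨ Q x) xs ≡ countᵇ P xs + countᵇ Q xs
  countᵇ-∨ P Q disjoint [] = refl
  countᵇ-∨ P Q disjoint (x ∷ xs) with P x | Q x | disjoint x | countᵇ-∨ P Q disjoint xs
  ... | true  | true  | d | _  = contradiction tt (d tt)
  ... | true  | false | _ | ih = cong suc ih
  ... | false | true  | _ | ih = trans (cong suc ih) (sym (+-suc _ _))
  ... | false | false | _ | ih = ih

length-≤-injection : {A B : Set} {xs : List A} {ys : List B} (f : A → B) → Unique xs →
                     (∀ {x} → x ∈ xs → f x ∈ ys) →
                     (∀ {x y} → x ∈ xs → y ∈ xs → f x ≡ f y → x ≡ y) →
                     length xs ≤ length ys
length-≤-injection f [] _ _ = z≤n
length-≤-injection {xs = x ∷ xs} f x∷xs!@(_ ∷ xs!) f∈ f-inj with ∈-∃++ (f∈ (here refl))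
... | ys₁ , ys₂ , refl = begin
  suc (length xs)                 ≤⟨ s≤s (length-≤-injection f xs! f∈′ (λ p q → f-inj (there p) (there q))) ⟩
  suc (length (ys₁ ++ ys₂))       ≡⟨ cong suc (length-++ ys₁) ⟩
  suc (length ys₁ + length ys₂)   ≡⟨ +-suc (length ys₁) (length ys₂) ⟨
  length ys₁ + length (f x ∷ ys₂) ≡⟨ length-++ ys₁ ⟨
  length (ys₁ ++ f x ∷ ys₂)       ∎
  where
  open ≤-Reasoning
  drop : ∀ {B : Set} (zs₁ : List B) {zs₂ v w} → v ∈ zs₁ ++ w ∷ zs₂ → v ≢ w → v ∈ zs₁ ++ zs₂
  drop []        (here v≡w) v≢w = contradiction v≡w v≢w
  drop []        (there p)  _   = p
  drop (_ ∷ zs₁) (here p)   _   = here p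
  drop (_ ∷ zs₁) (there p)  v≢w = there (drop zs₁ p v≢w)
  f∈′ : ∀ {y} → y ∈ xs → f y ∈ ys₁ ++ ys₂
  f∈′ y∈ = drop ys₁ (f∈ (there y∈))
    (λ fy≡fx → Unique[x∷xs]⇒x∉xs x∷xs! (subst (_∈ xs) (f-inj (there y∈) (here refl) fy≡fx) y∈))

record InverseOn {A B : Set} (P : A → Bool) (Q : B → Bool) : Set where
  field
    forward          : A → B
    backward         : B → A
    forward-T        : ∀ {x} → T (P x) → T (Q (forward x))
    backward-T       : ∀ {y} → T (Q y) → T (P (backward y))
    backward∘forward : ∀ {x} → T (P x) → backward (forward x) ≡ x
    forward∘backward : ∀ {y} → T (Q y) → forward (backward y) ≡ y

  inverse : InverseOn Q P
  inverse = record
    { forward = backward ; backward = forward ; forward-T = backward-T ; backward-T = forward-T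
    ; backward∘forward = forward∘backward ; forward∘backward = backward∘forward }

  forward-injective : ∀ {x y} → T (P x) → T (P y) → forward x ≡ forward y → x ≡ y
  forward-injective Px Py fx≡fy =
    trans (sym (backward∘forward Px)) (trans (cong backward fx≡fy) (backward∘forward Py))

countᵇ-≤ : {A B : Set} {P : A → Bool} {Q : B → Bool} {L : List A} {M : List B} →
           Unique L → (∀ {y} → T (Q y) → y ∈ M) → InverseOn P Q → countᵇ P L ≤ countᵇ Q M
countᵇ-≤ {P = P} {Q} {L} {M} L! M⊇Q inv = begin
  countᵇ P L                 ≡⟨ countᵇ≡length∘filter P L ⟩
  length (filter (T? ∘ P) L) ≤⟨ length-≤-injection forward (filter⁺ (T? ∘ P) L!) forward∈
                                  (λ p q → forward-injective (P-of p) (P-of q)) ⟩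
  length (filter (T? ∘ Q) M) ≡⟨ countᵇ≡length∘filter Q M ⟨
  countᵇ Q M                 ∎
  where
  open ≤-Reasoning
  open InverseOn inv
  P-of : ∀ {x} → x ∈ filter (T? ∘ P) L → T (P x)
  P-of = proj₂ ∘ ∈-filter⁻ (T? ∘ P) {xs = L}
  forward∈ : ∀ {x} → x ∈ filter (T? ∘ P) L → forward x ∈ filter (T? ∘ Q) M
  forward∈ p = ∈-filter⁺ (T? ∘ Q) (M⊇Q (forward-T (P-of p))) (forward-T (P-of p))

countᵇ-inverse : {A B : Set} {P : A → Bool} {Q : B → Bool} {L : List A} {M : List B} →
                 Unique L → Unique M → (∀ {x} → T (P x) → x ∈ L) → (∀ {y} → T (Q y) → y ∈ M) →
                 InverseOn P Q → countᵇ P L ≡ countᵇ Q M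
countᵇ-inverse L! M! L⊇P M⊇Q inv =
  ≤-antisym (countᵇ-≤ L! M⊇Q inv) (countᵇ-≤ M! L⊇P (InverseOn.inverse inv))

-- Canonical listings of overpartitions

CanPrecede : Part → Part → Set
CanPrecede (s₁ , b₁) (s₂ , b₂) = s₂ < s₁ ⊎ (s₁ ≡ s₂ × b₁ ≡ false)

CanPrecedeHead : Part → List Part → Set
CanPrecedeHead p []      = ⊤
CanPrecedeHead p (q ∷ _) = CanPrecede p q

data Valid : List Part → Set where
  []   : Valid []
  cons : ∀ {s b π} → 0 < s → CanPrecedeHead (s , b) π → Valid π → Valid ((s , b) ∷ π)

IsOverpartition : ℕ → List Part → Set
IsOverpartition n π = sizeSum π ≡ n × Valid π

T-adjOK : ∀ p q → T (adjOK p q) ⇔ CanPrecede p q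
T-adjOK (s₁ , b₁) (s₂ , b₂) = mk⇔ ⇒ ⇐
  where
  ⇒ : T (adjOK (s₁ , b₁) (s₂ , b₂)) → CanPrecede (s₁ , b₁) (s₂ , b₂)
  ⇒ t with to (T-∨ {s₂ <ᵇ s₁}) t
  ... | inj₁ s₂<s₁ = inj₁ (<ᵇ⇒< s₂ s₁ s₂<s₁)
  ... | inj₂ t′    = let s₁≡s₂ , ¬b₁ = to (T-∧ {s₁ ≡ᵇ s₂}) t′
                     in inj₂ (≡ᵇ⇒≡ s₁ s₂ s₁≡s₂ , to (T-not-≡ {b₁}) ¬b₁)
  ⇐ : CanPrecede (s₁ , b₁) (s₂ , b₂) → T (adjOK (s₁ , b₁) (s₂ , b₂))
  ⇐ (inj₁ s₂<s₁)        = from (T-∨ {s₂ <ᵇ s₁}) (inj₁ (<⇒<ᵇ s₂<s₁))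
  ⇐ (inj₂ (s₁≡s₂ , ¬b₁)) =
    from (T-∨ {s₂ <ᵇ s₁})
      (inj₂ (from (T-∧ {s₁ ≡ᵇ s₂}) (≡⇒≡ᵇ s₁ s₂ s₁≡s₂ , from (T-not-≡ {b₁}) ¬b₁)))

T-validᵇ : ∀ π → T (validᵇ π) ⇔ Valid π
T-validᵇ π = mk⇔ (⇒ π) ⇐
  where
  ⇒ : ∀ π → T (validᵇ π) → Valid π
  ⇒ []                t = []
  ⇒ ((s , b) ∷ [])     t = cons (<ᵇ⇒< 0 s t) tt []
  ⇒ ((s , b) ∷ q ∷ π) t =
    let s>0 , t′ = to (T-∧ {0 <ᵇ s}) t ; adj , t″ = to (T-∧ {adjOK (s , b) q}) t′
    in cons (<ᵇ⇒< 0 s s>0) (to (T-adjOK (s , b) q) adj) (⇒ (q ∷ π) t″)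
  ⇐ : ∀ {π} → Valid π → T (validᵇ π)
  ⇐ []                      = tt
  ⇐ (cons {π = []} s>0 _ _) = <⇒<ᵇ s>0
  ⇐ (cons {s} {b} {q ∷ π} s>0 adj v) =
    from (T-∧ {0 <ᵇ s}) (<⇒<ᵇ s>0 , from (T-∧ {adjOK (s , b) q}) (from (T-adjOK (s , b) q) adj , ⇐ v))

T-isOverpartitionᵇ : ∀ n π → T (isOverpartitionᵇ n π) ⇔ IsOverpartition n π
T-isOverpartitionᵇ n π = mk⇔
  (λ t → let size , valid = to (T-∧ {sizeSum π ≡ᵇ n}) t in ≡ᵇ⇒≡ _ _ size , to (T-validᵇ π) valid)
  (λ (size , valid) → from (T-∧ {sizeSum π ≡ᵇ n}) (≡⇒≡ᵇ _ _ size , from (T-validᵇ π) valid))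

T-occursNonOverlinedᵇ : ∀ m π → T (occursNonOverlinedᵇ m π) ⇔ (m , false) ∈ π
T-occursNonOverlinedᵇ m π = mk⇔ (⇒ π) (⇐ π)
  where
  ⇒ : ∀ π → T (occursNonOverlinedᵇ m π) → (m , false) ∈ π
  ⇒ ((s , b) ∷ π) t with to (T-∨ {(s ≡ᵇ m) ∧ not b}) t
  ... | inj₂ t′ = there (⇒ π t′)
  ... | inj₁ t′ with to (T-∧ {s ≡ᵇ m}) t′
  ... | s≡m , ¬b with ≡ᵇ⇒≡ s m s≡m | to (T-not-≡ {b}) ¬b
  ... | refl | refl = here refl
  ⇐ : ∀ π → (m , false) ∈ π → T (occursNonOverlinedᵇ m π)
  ⇐ (_ ∷ π) (here refl) =
    from (T-∨ {(m ≡ᵇ m) ∧ true}) (inj₁ (from (T-∧ {m ≡ᵇ m}) (≡⇒≡ᵇ m m refl , tt)))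
  ⇐ ((s , b) ∷ π) (there p) = from (T-∨ {(s ≡ᵇ m) ∧ not b}) (inj₂ (⇐ π p))

-- Inserting and deleting a non-overlined part

insertPart : ℕ → List Part → List Part
insertPart m [] = (m , false) ∷ []
insertPart m ((s , b) ∷ π) with s ≤? m
... | yes _ = (m , false) ∷ (s , b) ∷ π
... | no  _ = (s , b) ∷ insertPart m π

deletePart : ℕ → List Part → List Part
deletePart m [] = []
deletePart m ((s , true) ∷ π) = (s , true) ∷ deletePart m π
deletePart m ((s , false) ∷ π) with s ≟ m
... | yes _ = π
... | no  _ = (s , false) ∷ deletePart m π

CanPrecede-trans : ∀ p q r → CanPrecede p q → CanPrecede q r → CanPrecede p r
CanPrecede-trans _ _ _ (inj₁ q<p)        (inj₁ r<q)        = inj₁ (<-trans r<q q<p)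
CanPrecede-trans _ _ _ (inj₁ q<p)        (inj₂ (refl , _)) = inj₁ q<p
CanPrecede-trans _ _ _ (inj₂ (refl , _)) (inj₁ r<q)        = inj₁ r<q
CanPrecede-trans _ _ _ (inj₂ (refl , b)) (inj₂ (refl , _)) = inj₂ (refl , b)

CanPrecede⇒≥ : ∀ p q → CanPrecede p q → proj₁ q ≤ proj₁ p
CanPrecede⇒≥ _ _ (inj₁ q<p)        = <⇒≤ q<p
CanPrecede⇒≥ _ _ (inj₂ (refl , _)) = ≤-refl

Valid-sorted : ∀ {p π x} → Valid (p ∷ π) → x ∈ π → proj₁ x ≤ proj₁ p
Valid-sorted {p} {q ∷ _} (cons _ adj _) (here refl) = CanPrecede⇒≥ p q adj
Valid-sorted {p} {q ∷ _} (cons _ adj v) (there x∈) = ≤-trans (Valid-sorted v x∈) (CanPrecede⇒≥ p q adj)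

Valid-sorted-overlined : ∀ {s π x} → Valid ((s , true) ∷ π) → x ∈ π → proj₁ x < s
Valid-sorted-overlined {π = _ ∷ _} (cons _ (inj₁ q<s) _) (here refl) = q<s
Valid-sorted-overlined {π = _ ∷ _} (cons _ (inj₁ q<s) v) (there x∈) = ≤-<-trans (Valid-sorted v x∈) q<s

CanPrecedeHead-insertPart : ∀ p π m → CanPrecedeHead p π → m < proj₁ p →
                            CanPrecedeHead p (insertPart m π)
CanPrecedeHead-insertPart p [] m _ m<p = inj₁ m<p
CanPrecedeHead-insertPart p ((s , b) ∷ π) m adj m<p with s ≤? m
... | yes _ = inj₁ m<p
... | no  _ = adj

insertPart-Valid : ∀ {π} m → 0 < m → Valid π → Valid (insertPart m π)
insertPart-Valid m m>0 [] = cons m>0 tt []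
insertPart-Valid m m>0 (cons {s} {b} {π} s>0 adj v) with s ≤? m
... | no  s≰m = cons s>0 (CanPrecedeHead-insertPart (s , b) π m adj (≰⇒> s≰m)) (insertPart-Valid m m>0 v)
... | yes s≤m = cons m>0 m-first (cons s>0 adj v)
  where
  m-first : CanPrecede (m , false) (s , b)
  m-first with m≤n⇒m<n∨m≡n s≤m
  ... | inj₁ s<m = inj₁ s<m
  ... | inj₂ s≡m = inj₂ (sym s≡m , refl)

CanPrecedeHead-deletePart : ∀ p π m → CanPrecedeHead p π → Valid π → CanPrecedeHead p (deletePart m π)
CanPrecedeHead-deletePart p [] m _ _ = tt
CanPrecedeHead-deletePart p ((s , true) ∷ π) m adj _ = adj
CanPrecedeHead-deletePart p ((s , false) ∷ π) m adj (cons _ adj′ _) with s ≟ m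
... | no  _ = adj
CanPrecedeHead-deletePart p ((s , false) ∷ [])    m adj _ | yes _ = tt
CanPrecedeHead-deletePart p ((s , false) ∷ q ∷ π) m adj (cons _ adj′ _) | yes _ =
  CanPrecede-trans p (s , false) q adj adj′

deletePart-Valid : ∀ {π} m → Valid π → Valid (deletePart m π)
deletePart-Valid m [] = []
deletePart-Valid m (cons {s} {true} {π} s>0 adj v) =
  cons s>0 (CanPrecedeHead-deletePart (s , true) π m adj v) (deletePart-Valid m v)
deletePart-Valid m (cons {s} {false} {π} s>0 adj v) with s ≟ m
... | yes _ = v
... | no  _ = cons s>0 (CanPrecedeHead-deletePart (s , false) π m adj v) (deletePart-Valid m v)

sizeSum-insertPart : ∀ m π → sizeSum (insertPart m π) ≡ m + sizeSum π
sizeSum-insertPart m [] = refl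
sizeSum-insertPart m ((s , b) ∷ π) with s ≤? m
... | yes _ = refl
... | no  _ = begin
  s + sizeSum (insertPart m π) ≡⟨ cong (_+_ s) (sizeSum-insertPart m π) ⟩
  s + (m + sizeSum π)          ≡⟨ +-assoc s m _ ⟨
  s + m + sizeSum π            ≡⟨ cong (_+ sizeSum π) (+-comm s m) ⟩
  m + s + sizeSum π            ≡⟨ +-assoc m s _ ⟩
  m + (s + sizeSum π)          ∎
  where open ≡-Reasoning

length-insertPart : ∀ m π → length (insertPart m π) ≡ suc (length π)
length-insertPart m [] = refl
length-insertPart m ((s , b) ∷ π) with s ≤? m
... | yes _ = refl
... | no  _ = cong suc (length-insertPart m π)

∈-insertPart : ∀ m π → (m , false) ∈ insertPart m π
∈-insertPart m [] = here refl
∈-insertPart m ((s , b) ∷ π) with s ≤? m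
... | yes _ = here refl
... | no  _ = there (∈-insertPart m π)

∈-insertPart⁺ : ∀ {x} m π → x ∈ π → x ∈ insertPart m π
∈-insertPart⁺ m ((s , b) ∷ π) x∈ with s ≤? m
... | yes _ = there x∈
∈-insertPart⁺ m ((s , b) ∷ π) (here x≡) | no _ = here x≡
∈-insertPart⁺ m ((s , b) ∷ π) (there x∈) | no _ = there (∈-insertPart⁺ m π x∈)

∈-deletePart⁺ : ∀ {x} m π → x ∈ π → x ≢ (m , false) → x ∈ deletePart m π
∈-deletePart⁺ m ((s , true) ∷ π) (here x≡) _ = here x≡
∈-deletePart⁺ m ((s , true) ∷ π) (there x∈) x≢ = there (∈-deletePart⁺ m π x∈ x≢)
∈-deletePart⁺ m ((s , false) ∷ π) x∈ x≢ with s ≟ m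
∈-deletePart⁺ m ((s , false) ∷ π) (here refl) x≢ | yes refl = contradiction refl x≢
∈-deletePart⁺ m ((s , false) ∷ π) (there x∈) _  | yes _    = x∈
∈-deletePart⁺ m ((s , false) ∷ π) (here x≡)  _  | no _     = here x≡
∈-deletePart⁺ m ((s , false) ∷ π) (there x∈) x≢ | no _     = there (∈-deletePart⁺ m π x∈ x≢)

deletePart-insertPart : ∀ m π → deletePart m (insertPart m π) ≡ π
deletePart-insertPart m [] with m ≟ m
... | yes _   = refl
... | no  m≢m = contradiction refl m≢m
deletePart-insertPart m ((s , b) ∷ π) with s ≤? m
... | yes _ with m ≟ m
...   | yes _   = refl
...   | no  m≢m = contradiction refl m≢m
deletePart-insertPart m ((s , true) ∷ π)  | no _ = cong ((s , true) ∷_) (deletePart-insertPart m π)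
deletePart-insertPart m ((s , false) ∷ π) | no s≰m with s ≟ m
...   | yes refl = contradiction ≤-refl s≰m
...   | no  _    = cong ((s , false) ∷_) (deletePart-insertPart m π)

insertPart-deletePart : ∀ m π → Valid π → (m , false) ∈ π → insertPart m (deletePart m π) ≡ π
insertPart-deletePart m ((s , true) ∷ π) v@(cons _ _ v′) (there m∈) with s ≤? m
... | yes s≤m = contradiction s≤m (<⇒≱ (Valid-sorted-overlined v m∈))
... | no  _   = cong ((s , true) ∷_) (insertPart-deletePart m π v′ m∈)
insertPart-deletePart m ((s , false) ∷ π) v@(cons _ adj v′) m∈ with s ≟ m
insertPart-deletePart m ((s , false) ∷ []) _ _ | yes refl = refl
insertPart-deletePart m ((s , false) ∷ (s′ , b′) ∷ π) (cons _ adj _) _ | yes refl with s′ ≤? s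
... | yes _    = refl
... | no  s′≰s = contradiction (CanPrecede⇒≥ (s , false) (s′ , b′) adj) s′≰s
insertPart-deletePart m ((s , false) ∷ π) _ (here refl) | no s≢m = contradiction refl s≢m
insertPart-deletePart m ((s , false) ∷ π) v@(cons _ _ v′) (there m∈) | no s≢m with s ≤? m
... | yes s≤m = contradiction (≤-antisym s≤m (Valid-sorted v m∈)) s≢m
... | no  _   = cong ((s , false) ∷_) (insertPart-deletePart m π v′ m∈)

OddPartsBelow : ℕ → List Part → Set
OddPartsBelow j π = ∀ i → i < j → (2 * i + 1 , false) ∈ π

insertOddParts : ℕ → List Part → List Part
insertOddParts zero    π = π
insertOddParts (suc j) π = insertPart (2 * j + 1) (insertOddParts j π)

deleteOddParts : ℕ → List Part → List Part
deleteOddParts zero    π = π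
deleteOddParts (suc j) π = deleteOddParts j (deletePart (2 * j + 1) π)

2*-+1-mono-≤ : ∀ {j k} → j ≤ k → 2 * j + 1 ≤ 2 * k + 1
2*-+1-mono-≤ j≤k = +-monoˡ-≤ 1 (*-monoʳ-≤ 2 j≤k)

2*-+1-mono-< : ∀ {j k} → j < k → 2 * j + 1 < 2 * k + 1
2*-+1-mono-< j<k = +-monoˡ-< 1 (*-monoʳ-< 2 j<k)

insertOddParts-Valid : ∀ j {π} → Valid π → Valid (insertOddParts j π)
insertOddParts-Valid zero    v = v
insertOddParts-Valid (suc j) v = insertPart-Valid (2 * j + 1) (m≤n+m 1 (2 * j)) (insertOddParts-Valid j v)

deleteOddParts-Valid : ∀ j {π} → Valid π → Valid (deleteOddParts j π)
deleteOddParts-Valid zero    v = v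
deleteOddParts-Valid (suc j) v = deleteOddParts-Valid j (deletePart-Valid (2 * j + 1) v)

OddPartsBelow-insertOddParts : ∀ j π → OddPartsBelow j (insertOddParts j π)
OddPartsBelow-insertOddParts (suc j) π i i<1+j with m≤n⇒m<n∨m≡n (≤-pred i<1+j)
... | inj₁ i<j  = ∈-insertPart⁺ (2 * j + 1) (insertOddParts j π) (OddPartsBelow-insertOddParts j π i i<j)
... | inj₂ refl = ∈-insertPart (2 * i + 1) (insertOddParts i π)

sizeSum-insertOddParts : ∀ j π → sizeSum (insertOddParts j π) ≡ j * j + sizeSum π
sizeSum-insertOddParts zero    π = refl
sizeSum-insertOddParts (suc j) π = begin
  sizeSum (insertPart (2 * j + 1) (insertOddParts j π))
    ≡⟨ sizeSum-insertPart (2 * j + 1) (insertOddParts j π) ⟩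
  2 * j + 1 + sizeSum (insertOddParts j π)
    ≡⟨ cong (_+_ (2 * j + 1)) (sizeSum-insertOddParts j π) ⟩
  2 * j + 1 + (j * j + sizeSum π)
    ≡⟨ square-suc j (sizeSum π) ⟩
  suc j * suc j + sizeSum π ∎
  where
  open ≡-Reasoning
  square-suc : ∀ j s → 2 * j + 1 + (j * j + s) ≡ suc j * suc j + s
  square-suc = solve-∀

length-insertOddParts : ∀ j π → length (insertOddParts j π) ≡ j + length π
length-insertOddParts zero    π = refl
length-insertOddParts (suc j) π =
  trans (length-insertPart (2 * j + 1) (insertOddParts j π)) (cong suc (length-insertOddParts j π))

deleteOddParts-insertOddParts : ∀ j π → deleteOddParts j (insertOddParts j π) ≡ π
deleteOddParts-insertOddParts zero    π = refl
deleteOddParts-insertOddParts (suc j) π =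
  trans (cong (deleteOddParts j) (deletePart-insertPart (2 * j + 1) (insertOddParts j π)))
        (deleteOddParts-insertOddParts j π)

insertOddParts-deleteOddParts : ∀ j π → Valid π → OddPartsBelow j π →
                                insertOddParts j (deleteOddParts j π) ≡ π
insertOddParts-deleteOddParts zero    π _ _    = refl
insertOddParts-deleteOddParts (suc j) π v odds = begin
  insertPart m (insertOddParts j (deleteOddParts j (deletePart m π)))
    ≡⟨ cong (insertPart m) (insertOddParts-deleteOddParts j _ (deletePart-Valid m v) odds′) ⟩
  insertPart m (deletePart m π)
    ≡⟨ insertPart-deletePart m π v (odds j ≤-refl) ⟩
  π ∎
  where
  open ≡-Reasoning
  m = 2 * j + 1
  odds′ : OddPartsBelow j (deletePart m π)
  odds′ i i<j = ∈-deletePart⁺ m π (odds i (m<n⇒m<1+n i<j)) (<⇒≢ (2*-+1-mono-< i<j) ∘ cong proj₁)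

module _ {j π} (v : Valid π) (odds : OddPartsBelow j π) where

  OddPartsBelow⇒length-≥ : j ≤ length π
  OddPartsBelow⇒length-≥ = subst (j ≤_) length-π (m≤m+n j _)
    where
    length-π : j + length (deleteOddParts j π) ≡ length π
    length-π = trans (sym (length-insertOddParts j _)) (cong length (insertOddParts-deleteOddParts j π v odds))

  OddPartsBelow⇒sizeSum : j * j + sizeSum (deleteOddParts j π) ≡ sizeSum π
  OddPartsBelow⇒sizeSum =
    trans (sym (sizeSum-insertOddParts j _)) (cong sizeSum (insertOddParts-deleteOddParts j π v odds))

-- The minimal excluded odd part

2*[1+k]+c≡2*k+[2+c] : ∀ k c → 2 * suc k + c ≡ 2 * k + (2 + c)
2*[1+k]+c≡2*k+[2+c] = solve-∀

mexAux-odd : ∀ f c π → ∃[ k ] mexAux f c π ≡ 2 * k + c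
mexAux-odd zero    c π = 0 , refl
mexAux-odd (suc f) c π with occursNonOverlinedᵇ c π
... | false = 0 , refl
... | true  = let k , mex≡ = mexAux-odd f (2 + c) π
              in suc k , trans mex≡ (sym (2*[1+k]+c≡2*k+[2+c] k c))

mexAux-≥⁻ : ∀ f c π k → 2 * k + c ≤ mexAux f c π → ∀ i → i < k → (2 * i + c , false) ∈ π
mexAux-≥⁻ zero    c π (suc k) mex≥ i i<k = contradiction mex≥ (<⇒≱ (m<n+m c z<s))
mexAux-≥⁻ (suc f) c π (suc k) mex≥ i i<k with occursNonOverlinedᵇ c π in c∈π
... | false = contradiction mex≥ (<⇒≱ (m<n+m c z<s))
mexAux-≥⁻ (suc f) c π (suc k) mex≥ zero    _         | true =
  to (T-occursNonOverlinedᵇ c π) (from T-≡ c∈π)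
mexAux-≥⁻ (suc f) c π (suc k) mex≥ (suc i) (s≤s i<k) | true =
  subst (λ x → (x , false) ∈ π) (sym (2*[1+k]+c≡2*k+[2+c] i c))
    (mexAux-≥⁻ f (2 + c) π k (subst (_≤ mexAux f (2 + c) π) (2*[1+k]+c≡2*k+[2+c] k c) mex≥) i i<k)

mexAux-≥⁺ : ∀ f c π k → k ≤ f → (∀ i → i < k → (2 * i + c , false) ∈ π) → 2 * k + c ≤ mexAux f c π
mexAux-≥⁺ f c π zero _ _ =
  let k , mex≡ = mexAux-odd f c π in subst (c ≤_) (sym mex≡) (m≤n+m c (2 * k))
mexAux-≥⁺ (suc f) c π (suc k) (s≤s k≤f) odds
  with occursNonOverlinedᵇ c π | from (T-occursNonOverlinedᵇ c π) (odds 0 z<s)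
... | false | ()
... | true  | _  = subst (_≤ mexAux f (2 + c) π) (sym (2*[1+k]+c≡2*k+[2+c] k c))
  (mexAux-≥⁺ f (2 + c) π k k≤f
    (λ i i<k → subst (λ x → (x , false) ∈ π) (2*[1+k]+c≡2*k+[2+c] i c) (odds (suc i) (s≤s i<k))))

-- opCondᵇ k π is definitionally mexCond k (mex21 π).
mexCond : ℕ → ℕ → Bool
mexCond k M = ((2 * k + 1) ≤ᵇ M) ∧ ((M % 4) ≡ᵇ ((2 * k + 1) % 4))

oddResidue : ℕ → ℕ
oddResidue k = (2 * k + 1) % 4

oddResidue-+2 : ∀ k → oddResidue (2 + k) ≡ oddResidue k
oddResidue-+2 k = trans (cong (_% 4) (2*[2+k]+1≡2*k+1+4 k)) ([m+n]%n≡m%n (2 * k + 1) 4)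
  where
  2*[2+k]+1≡2*k+1+4 : ∀ k → 2 * (2 + k) + 1 ≡ 2 * k + 1 + 4
  2*[2+k]+1≡2*k+1+4 = solve-∀

oddResidue-suc-≢ : ∀ j → oddResidue (suc j) ≢ oddResidue j
oddResidue-suc-≢ zero          = λ ()
oddResidue-suc-≢ (suc zero)    = λ ()
oddResidue-suc-≢ (suc (suc j)) eq =
  oddResidue-suc-≢ j (trans (sym (oddResidue-+2 (suc j))) (trans eq (oddResidue-+2 j)))

oddResidue-cases : ∀ j k → oddResidue k ≡ oddResidue j ⊎ oddResidue k ≡ oddResidue (suc j)
oddResidue-cases j (suc (suc k)) =
  Sum.map (trans (oddResidue-+2 k)) (trans (oddResidue-+2 k)) (oddResidue-cases j k)
oddResidue-cases (suc (suc j)) k =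
  Sum.map (λ eq → trans eq (sym (oddResidue-+2 j))) (λ eq → trans eq (sym (oddResidue-+2 (suc j))))
    (oddResidue-cases j k)
oddResidue-cases zero       zero       = inj₁ refl
oddResidue-cases zero       (suc zero) = inj₂ refl
oddResidue-cases (suc zero) zero       = inj₂ refl
oddResidue-cases (suc zero) (suc zero) = inj₁ refl

≤ᵇ-true : ∀ {m n} → m ≤ n → (m ≤ᵇ n) ≡ true
≤ᵇ-true m≤n = to T-≡ (≤⇒≤ᵇ m≤n)

≤ᵇ-false : ∀ {m n} → n < m → (m ≤ᵇ n) ≡ false
≤ᵇ-false {m} {n} n<m with m ≤ᵇ n in m≤ᵇn
... | true  = contradiction (≤ᵇ⇒≤ m n (from T-≡ m≤ᵇn)) (<⇒≱ n<m)
... | false = refl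

≡ᵇ-true : ∀ {m n} → m ≡ n → (m ≡ᵇ n) ≡ true
≡ᵇ-true {m} {n} m≡n = to T-≡ (≡⇒≡ᵇ m n m≡n)

mexCond-disjoint : ∀ j M → T (mexCond j M) → ¬ T (mexCond (suc j) M)
mexCond-disjoint j M t t′ = oddResidue-suc-≢ j (trans (sym (residue {suc j} t′)) (residue {j} t))
  where
  residue : ∀ {k} → T (mexCond k M) → M % 4 ≡ oddResidue k
  residue {k} t = ≡ᵇ⇒≡ _ _ (proj₂ (to (T-∧ {2 * k + 1 ≤ᵇ M}) t))

mexCond-split : ∀ j {M} k → M ≡ 2 * k + 1 → mexCond j M ∨ mexCond (suc j) M ≡ (2 * j + 1 ≤ᵇ M)
mexCond-split j k refl with <-cmp j k
... | tri< j<k _ _ rewrite ≤ᵇ-true (2*-+1-mono-≤ (<⇒≤ j<k)) | ≤ᵇ-true (2*-+1-mono-≤ j<k)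
  with oddResidue-cases j k
...   | inj₁ same rewrite ≡ᵇ-true same = refl
...   | inj₂ same rewrite ≡ᵇ-true same = ∨-zeroʳ _
mexCond-split j k refl | tri≈ _ refl _
  rewrite ≤ᵇ-true (≤-refl {2 * j + 1}) | ≡ᵇ-true (refl {x = oddResidue j}) = refl
mexCond-split j k refl | tri> _ _ k<j
  rewrite ≤ᵇ-false (2*-+1-mono-< k<j) | ≤ᵇ-false (2*-+1-mono-< (m<n⇒m<1+n k<j)) = refl

-- Overpartitions with mex̄₂,₁ ≥ 2j+1

mexAtLeastᵇ : ℕ → ℕ → List Part → Bool
mexAtLeastᵇ n j π = isOverpartitionᵇ n π ∧ ((2 * j + 1) ≤ᵇ mex21 π)

T-mexAtLeastᵇ : ∀ n j π → T (mexAtLeastᵇ n j π) ⇔ (IsOverpartition n π × OddPartsBelow j π)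
T-mexAtLeastᵇ n j π = mk⇔ ⇒ ⇐
  where
  ⇒ : T (mexAtLeastᵇ n j π) → IsOverpartition n π × OddPartsBelow j π
  ⇒ t = let op , mex≥ = to (T-∧ {isOverpartitionᵇ n π}) t
        in to (T-isOverpartitionᵇ n π) op , mexAux-≥⁻ (length π) 1 π j (≤ᵇ⇒≤ _ _ mex≥)
  ⇐ : IsOverpartition n π × OddPartsBelow j π → T (mexAtLeastᵇ n j π)
  ⇐ (op@(_ , v) , odds) = from (T-∧ {isOverpartitionᵇ n π})
    (from (T-isOverpartitionᵇ n π) op ,
     ≤⇒≤ᵇ (mexAux-≥⁺ (length π) 1 π j (OddPartsBelow⇒length-≥ v odds) odds))

op21-+-op21 : ∀ n j → op21 n j + op21 n (suc j) ≡ countᵇ (mexAtLeastᵇ n j) (candidates n)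
op21-+-op21 n j = begin
  op21 n j + op21 n (suc j)                ≡⟨ countᵇ-∨ (opAt j) (opAt (suc j)) disjoint (candidates n) ⟨
  countᵇ (λ π → opAt j π ∨ opAt (suc j) π) (candidates n) ≡⟨ countᵇ-cong split (candidates n) ⟩
  countᵇ (mexAtLeastᵇ n j) (candidates n)   ∎
  where
  open ≡-Reasoning
  opAt : ℕ → List Part → Bool
  opAt k π = isOverpartitionᵇ n π ∧ opCondᵇ k π
  disjoint : ∀ π → T (opAt j π) → ¬ T (opAt (suc j) π)
  disjoint π t t′ = mexCond-disjoint j (mex21 π)
    (proj₂ (to (T-∧ {isOverpartitionᵇ n π}) t)) (proj₂ (to (T-∧ {isOverpartitionᵇ n π}) t′))
  split : ∀ π → opAt j π ∨ opAt (suc j) π ≡ mexAtLeastᵇ n j π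
  split π = let k , mex≡ = mexAux-odd (length π) 1 π
            in trans (sym (∧-distribˡ-∨ (isOverpartitionᵇ n π) _ _))
                     (cong (isOverpartitionᵇ n π ∧_) (mexCond-split j k mex≡))

-- Completeness and uniqueness of the enumeration

module _ {A B : Set} (f : A → List B) where

  Unique-concatMap⁺ : ∀ {xs} → Unique xs → (∀ x → Unique (f x)) →
                      (∀ {x y z} → z ∈ f x → z ∈ f y → x ≡ y) → Unique (concatMap f xs)
  Unique-concatMap⁺ {[]}     _ _ _ = []
  Unique-concatMap⁺ {x ∷ xs} x∷xs!@(_ ∷ xs!) f! f-disjoint =
    ++⁺ (f! x) (Unique-concatMap⁺ xs! f! f-disjoint)
      (λ (z∈fx , z∈rest) →
        Unique[x∷xs]⇒x∉xs x∷xs! (Any.map (f-disjoint z∈fx) (∈-concatMap⁻ f z∈rest)))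

module _ {A : Set} where

  length-∈-listsOfLen : ∀ k (xs : List A) {ys} → ys ∈ listsOfLen k xs → length ys ≡ k
  length-∈-listsOfLen zero    xs (here refl) = refl
  length-∈-listsOfLen zero    xs (there ())
  length-∈-listsOfLen (suc k) xs ys∈ with find (∈-concatMap⁻ _ {xs = xs} ys∈)
  ... | x , _ , ys∈x∷ with ∈-map⁻ (x ∷_) ys∈x∷
  ...   | zs , zs∈ , refl = cong suc (length-∈-listsOfLen k xs zs∈)

  listsOfLen-Unique : ∀ k {xs : List A} → Unique xs → Unique (listsOfLen k xs)
  listsOfLen-Unique zero    _   = [] ∷ []
  listsOfLen-Unique (suc k) xs! =
    Unique-concatMap⁺ _ xs! (λ x → map⁺ ∷-injectiveʳ (listsOfLen-Unique k xs!)) same-head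
    where
    same-head : ∀ {x y zs} →
                zs ∈ map (x ∷_) (listsOfLen k _) → zs ∈ map (y ∷_) (listsOfLen k _) → x ≡ y
    same-head p q with ∈-map⁻ _ p | ∈-map⁻ _ q
    ... | _ , _ , refl | _ , _ , refl = refl

  ∈-listsOfLen : ∀ {xs ys : List A} → ys ⊆ xs → ys ∈ listsOfLen (length ys) xs
  ∈-listsOfLen {ys = []}     _    = here refl
  ∈-listsOfLen {ys = y ∷ ys} ys⊆ =
    ∈-concatMap⁺ _ (lose (ys⊆ (here refl)) (∈-map⁺ (y ∷_) (∈-listsOfLen (ys⊆ ∘ there))))

partsOfSize1+ : ℕ → List Part
partsOfSize1+ i = (suc i , false) ∷ (suc i , true) ∷ []

size-∈-partsOfSize1+ : ∀ i {p} → p ∈ partsOfSize1+ i → proj₁ p ≡ suc i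
size-∈-partsOfSize1+ i (here refl)         = refl
size-∈-partsOfSize1+ i (there (here refl)) = refl

partsUpTo-Unique : ∀ n → Unique (partsUpTo n)
partsUpTo-Unique n = Unique-concatMap⁺ partsOfSize1+ (upTo⁺ n) (λ i → ((λ ()) ∷ []) ∷ [] ∷ [])
  (λ p q → suc-injective (trans (sym (size-∈-partsOfSize1+ _ p)) (size-∈-partsOfSize1+ _ q)))

∈-partsUpTo : ∀ {n s} b → 0 < s → s ≤ n → (s , b) ∈ partsUpTo n
∈-partsUpTo {s = suc i} false _ s≤n = ∈-concatMap⁺ partsOfSize1+ (lose (∈-upTo⁺ s≤n) (here refl))
∈-partsUpTo {s = suc i} true  _ s≤n = ∈-concatMap⁺ partsOfSize1+ (lose (∈-upTo⁺ s≤n) (there (here refl)))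

candidates-Unique : ∀ n → Unique (candidates n)
candidates-Unique n = Unique-concatMap⁺ _ (upTo⁺ (suc n)) (λ k → listsOfLen-Unique k (partsUpTo-Unique n))
  (λ p q → trans (sym (length-∈-listsOfLen _ _ p)) (length-∈-listsOfLen _ _ q))

Valid⇒length-≤ : ∀ {π} → Valid π → length π ≤ sizeSum π
Valid⇒length-≤ []               = z≤n
Valid⇒length-≤ (cons s>0 _ v) = +-mono-≤ s>0 (Valid⇒length-≤ v)

Valid⇒part>0 : ∀ {π p} → Valid π → p ∈ π → 0 < proj₁ p
Valid⇒part>0 (cons s>0 _ _) (here refl) = s>0
Valid⇒part>0 (cons _ _ v)   (there p∈)  = Valid⇒part>0 v p∈

part≤sizeSum : ∀ {π p} → p ∈ π → proj₁ p ≤ sizeSum π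
part≤sizeSum {(s , _) ∷ π} (here refl) = m≤m+n s (sizeSum π)
part≤sizeSum {(s , _) ∷ π} (there p∈)  = ≤-trans (part≤sizeSum p∈) (m≤n+m (sizeSum π) s)

∈-candidates : ∀ {n π} → IsOverpartition n π → π ∈ candidates n
∈-candidates {π = π} (refl , v) =
  ∈-concatMap⁺ (λ k → listsOfLen k (partsUpTo (sizeSum π))) (lose (∈-upTo⁺ (s≤s (Valid⇒length-≤ v)))
    (∈-listsOfLen (λ {(s , b)} p∈ → ∈-partsUpTo b (Valid⇒part>0 v p∈) (part≤sizeSum p∈))))

isOverpartitionᵇ⇒∈candidates : ∀ {n π} → T (isOverpartitionᵇ n π) → π ∈ candidates n
isOverpartitionᵇ⇒∈candidates {n} {π} = ∈-candidates ∘ to (T-isOverpartitionᵇ n π)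

removeOddParts : ∀ n j → j * j ≤ n → InverseOn (mexAtLeastᵇ n j) (isOverpartitionᵇ (n ∸ j * j))
removeOddParts n j j²≤n = record
  { forward          = deleteOddParts j
  ; backward         = insertOddParts j
  ; forward-T        = λ t → let (size , v) , odds = to (T-mexAtLeastᵇ n j _) t in
      from (T-isOverpartitionᵇ _ _)
        (∸-solve (trans (OddPartsBelow⇒sizeSum v odds) size) , deleteOddParts-Valid j v)
  ; backward-T       = λ t → let size , v = to (T-isOverpartitionᵇ _ _) t in
      from (T-mexAtLeastᵇ n j _)
        ((trans (sizeSum-insertOddParts j _) (trans (cong (_+_ (j * j)) size) (m+[n∸m]≡n j²≤n)) ,
          insertOddParts-Valid j v) , OddPartsBelow-insertOddParts j _)
  ; backward∘forward = λ t → let (_ , v) , odds = to (T-mexAtLeastᵇ n j _) t in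
      insertOddParts-deleteOddParts j _ v odds
  ; forward∘backward = λ _ → deleteOddParts-insertOddParts j _
  }
  where
  ∸-solve : ∀ {s} → j * j + s ≡ n → s ≡ n ∸ j * j
  ∸-solve {s} eq = trans (sym (m+n∸m≡n (j * j) s)) (cong (_∸ j * j) eq)

countᵇ-mexAtLeastᵇ : ∀ n j → j * j ≤ n → countᵇ (mexAtLeastᵇ n j) (candidates n) ≡ pbar (n ∸ j * j)
countᵇ-mexAtLeastᵇ n j j²≤n =
  countᵇ-inverse (candidates-Unique n) (candidates-Unique (n ∸ j * j))
    (λ {π} → isOverpartitionᵇ⇒∈candidates ∘ proj₁ ∘ to (T-∧ {isOverpartitionᵇ n π}))
    isOverpartitionᵇ⇒∈candidates (removeOddParts n j j²≤n)

countᵇ-mexAtLeastᵇ-none : ∀ n j → n < j * j → countᵇ (mexAtLeastᵇ n j) (candidates n) ≡ 0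
countᵇ-mexAtLeastᵇ-none n j n<j² = countᵇ-none (mexAtLeastᵇ n j) square≤n (candidates n)
  where
  square≤n : ∀ π → ¬ T (mexAtLeastᵇ n j π)
  square≤n π t = let (size , v) , odds = to (T-mexAtLeastᵇ n j π) t in
    <⇒≱ n<j² (subst (j * j ≤_) (trans (OddPartsBelow⇒sizeSum v odds) size) (m≤m+n (j * j) _))

pbarℤ-∸ : ∀ {m n} → m ≤ n → pbarℤ (+ n - + m) ≡ pbar (n ∸ m)
pbarℤ-∸ {m} {n} m≤n rewrite m-n≡m⊖n n m | ⊖-≥ m≤n = refl

pbarℤ-< : ∀ {m n} → n < m → pbarℤ (+ n - + m) ≡ 0
pbarℤ-< {m} {n} n<m rewrite m-n≡m⊖n n m | ⊖-< n<m with m ∸ n | m<n⇒0<n∸m n<m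
... | suc _ | _ = refl

lemma4p1 : (n j : ℕ) → n ≥ 1 → j ≥ 1 →
    pbarℤ (+ n - + (j * j)) ≡ op21 n j + op21 n (suc j)
lemma4p1 n j _ _ = trans pbarℤ≡count (sym (op21-+-op21 n j))
  where
  pbarℤ≡count : pbarℤ (+ n - + (j * j)) ≡ countᵇ (mexAtLeastᵇ n j) (candidates n)
  pbarℤ≡count with j * j ≤? n
  ... | yes j²≤n = trans (pbarℤ-∸ j²≤n) (sym (countᵇ-mexAtLeastᵇ n j j²≤n))
  ... | no  j²≰n = trans (pbarℤ-< (≰⇒> j²≰n)) (sym (countᵇ-mexAtLeastᵇ-none n j (≰⇒> j²≰n)))
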